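{- There exists a structure of cardinality $3$ that is a model of $(\Sigma^\sharp \setminus \{B6\}) \cup \{\neg B6\}$, where $\Sigma^\sharp$ is the axiom system described in the context.
   Context: Work in classical one-sorted first-order logic with equality, in the language with three constant symbols $a_0, a_1, a_2$, a ternary relation symbol $L$ (collinearity) and a ternary function symbol $\tau$. Write $\sigma(a,b)$ as an abbreviation for $\tau(b,a,a)$. The axioms below are understood as universally closed: A3: $a \ne b \wedge L(a,b,c) \wedge L(a,b,d) \rightarrow L(a,c,d)$; B1: $L(a,b,c) \rightarrow L(b,a,c)$; B2: $\tau(a,b,c) = \tau(a,c,b)$; B3: $L(a,b,\sigma(a,b))$; B4: $L(a,b,c) \rightarrow L(x, \tau(a,b,x), \tau(a,c,x))$; B6: $\tau(a,b,x) = \tau(c, \tau(a,b,x), x)$; B7: $\neg L(a_0,a_1,a_2)$; B8: $\sigma(a,b) = b \rightarrow a = b$. $\Sigma^\sharp$ is the set $\{A3,B1,B2,B3,B4,B6,B7,B8\}$. -}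

module Defs where

open import Data.Nat using (ℕ)
open import Data.Fin using (Fin)
open import Data.Product using (_×_)
open import Relation.Binary.PropositionalEquality using (_≡_; _≢_)
open import Relation.Nullary using (¬_)
open import Function.Bundles using (_⤖_)

-- A structure for the language {a₀, a₁, a₂, L, τ}, with equality interpreted
-- as (propositional) identity on the carrier.
record Structure : Set₁ where
  field
    Carrier : Set
    a₀ a₁ a₂ : Carrier
    L : Carrier → Carrier → Carrier → Set
    τ : Carrier → Carrier → Carrier → Carrier

module _ (M : Structure) where
  open Structure M

  σ : Carrier → Carrier → Carrier
  σ a b = τ b a a

  A3 B1 B2 B3 B4 B6 B7 B8 : Set
  A3 = ∀ a b c d → a ≢ b → L a b c → L a b d → L a c d
  B1 = ∀ a b c → L a b c → L b a c
  B2 = ∀ a b c → τ a b c ≡ τ a c b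
  B3 = ∀ a b → L a b (σ a b)
  B4 = ∀ a b c x → L a b c → L x (τ a b x) (τ a c x)
  B6 = ∀ a b c x → τ a b x ≡ τ c (τ a b x) x
  B7 = ¬ L a₀ a₁ a₂
  B8 = ∀ a b → σ a b ≡ b → a ≡ b

  ModelOfΣ♯withoutB6plusNegB6 : Set
  ModelOfΣ♯withoutB6plusNegB6 =
    A3 × B1 × B2 × B3 × B4 × B7 × B8 × ¬ B6

  HasCardinality : ℕ → Set
  HasCardinality n = Carrier ⤖ Fin n

-- Interpret L as "two of the three points coincide" and τ a b c as b when b = c,
-- and as a otherwise. Since τ a b x is always x or a, the triples required by B3
-- and B4 are degenerate; and when a ≠ b, a triple (a, b, c) is degenerate only if
-- c ∈ {a, b}, which gives A3. So all axioms except B7 hold on any set with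
-- decidable equality. B7 asks for three distinct constants p, q, r, and these
-- refute B6: τ p q r = p, but τ q (τ p q r) r = q.
module Submission where

open import Defs
open import Data.Product using (Σ; _×_; _,_)
open import Data.Sum using (_⊎_; inj₁; inj₂; [_,_])
open import Data.Empty using (⊥-elim)
open import Data.Fin using (Fin; zero; suc)
open import Data.Fin.Properties using (_≟_)
open import Function.Construct.Identity using (⤖-id)
open import Relation.Nullary using (¬_; Dec; yes; no)
open import Relation.Binary.Definitions using (DecidableEquality)
open import Relation.Binary.PropositionalEquality
  using (_≡_; _≢_; refl; sym; trans; cong; subst; module ≡-Reasoning)

module DegenerateModel {A : Set} (_≟A_ : DecidableEquality A) where

  Degenerate : A → A → A → Set
  Degenerate a b c = a ≡ b ⊎ b ≡ c ⊎ a ≡ c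

  agreeOr : A → A → A → A
  agreeOr a b c with b ≟A c
  ... | yes _ = b
  ... | no _  = a

  agreeOr-≡ : ∀ a b → agreeOr a b b ≡ b
  agreeOr-≡ a b with b ≟A b
  ... | yes _   = refl
  ... | no b≢b  = ⊥-elim (b≢b refl)

  agreeOr-≢ : ∀ a {b c} → b ≢ c → agreeOr a b c ≡ a
  agreeOr-≢ a {b} {c} b≢c with b ≟A c
  ... | yes b≡c = ⊥-elim (b≢c b≡c)
  ... | no _    = refl

  agreeOr-cases : ∀ a b c → agreeOr a b c ≡ c ⊎ agreeOr a b c ≡ a
  agreeOr-cases a b c with b ≟A c
  ... | yes b≡c = inj₁ b≡c
  ... | no _    = inj₂ refl

  degenerate⇒≡ˡ⊎≡ʳ : ∀ {a b c} → a ≢ b → Degenerate a b c → c ≡ a ⊎ c ≡ b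
  degenerate⇒≡ˡ⊎≡ʳ a≢b (inj₁ a≡b)        = ⊥-elim (a≢b a≡b)
  degenerate⇒≡ˡ⊎≡ʳ a≢b (inj₂ (inj₁ b≡c)) = inj₂ (sym b≡c)
  degenerate⇒≡ˡ⊎≡ʳ a≢b (inj₂ (inj₂ a≡c)) = inj₁ (sym a≡c)

  structure : (p q r : A) → Structure
  structure p q r = record
    { Carrier = A ; a₀ = p ; a₁ = q ; a₂ = r ; L = Degenerate ; τ = agreeOr }

  module _ (p q r : A) where

    private
      M : Structure
      M = structure p q r

    a3 : A3 M
    a3 a b c d a≢b abc abd
      with degenerate⇒≡ˡ⊎≡ʳ a≢b abc | degenerate⇒≡ˡ⊎≡ʳ a≢b abd
    ... | inj₁ c≡a | _        = inj₁ (sym c≡a)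
    ... | _        | inj₁ d≡a = inj₂ (inj₂ (sym d≡a))
    ... | inj₂ c≡b | inj₂ d≡b = inj₂ (inj₁ (trans c≡b (sym d≡b)))

    b1 : B1 M
    b1 a b c (inj₁ a≡b)        = inj₁ (sym a≡b)
    b1 a b c (inj₂ (inj₁ b≡c)) = inj₂ (inj₂ b≡c)
    b1 a b c (inj₂ (inj₂ a≡c)) = inj₂ (inj₁ a≡c)

    b2 : B2 M
    b2 a b c = by-cases (b ≟A c)
      where
      by-cases : Dec (b ≡ c) → agreeOr a b c ≡ agreeOr a c b
      by-cases (yes refl) = refl
      by-cases (no b≢c)   =
        trans (agreeOr-≢ a b≢c) (sym (agreeOr-≢ a (λ c≡b → b≢c (sym c≡b))))

    b3 : B3 M
    b3 a b = subst (Degenerate a b) (sym (agreeOr-≡ b a)) (inj₂ (inj₂ refl))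

    b4 : B4 M
    b4 a b c x _ with agreeOr-cases a b x | agreeOr-cases a c x
    ... | inj₁ ≡x | _       = inj₁ (sym ≡x)
    ... | _       | inj₁ ≡x = inj₂ (inj₂ (sym ≡x))
    ... | inj₂ ≡a | inj₂ ≡a′ = inj₂ (inj₁ (trans ≡a (sym ≡a′)))

    b8 : B8 M
    b8 a b σab≡b = trans (sym (agreeOr-≡ b a)) σab≡b

    module _ (p≢q : p ≢ q) (q≢r : q ≢ r) (p≢r : p ≢ r) where

      b7 : B7 M
      b7 = [ p≢q , [ q≢r , p≢r ] ]

      ¬b6 : ¬ B6 M
      ¬b6 b6 = p≢q (begin
        p                               ≡⟨ sym (agreeOr-≢ p q≢r) ⟩
        agreeOr p q r                   ≡⟨ b6 p q q r ⟩
        agreeOr q (agreeOr p q r) r     ≡⟨ cong (λ y → agreeOr q y r) (agreeOr-≢ p q≢r) ⟩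
        agreeOr q p r                   ≡⟨ agreeOr-≢ q p≢r ⟩
        q                               ∎)
        where open ≡-Reasoning

      model : ModelOfΣ♯withoutB6plusNegB6 M
      model = a3 , b1 , b2 , b3 , b4 , b7 , b8 , ¬b6

open DegenerateModel (_≟_ {3})

proposition8 : Σ (Structure) (λ M → HasCardinality M 3 × ModelOfΣ♯withoutB6plusNegB6 M)
proposition8 =
  structure p q r , ⤖-id (Fin 3) , model p q r (λ ()) (λ ()) (λ ())
  where
  p q r : Fin 3
  p = zero
  q = suc zero
  r = suc (suc zero)
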